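{- For $n\ge 1$ let $p_n=\Psi(P_n)$, $m_n=\Psi(M_n)$, $o_n=\Psi(O_n)$, and set $p_0=m_0=o_0=1$. Then, as formal power series, $$\sum_{n\ge 0}p_nx^n=\frac{1+4x^2}{1-5x+4x^2-4x^3},\qquad \sum_{n\ge 0}m_nx^n=\frac{1-x-2x^2}{1-6x+3x^2-2x^3},\qquad \sum_{n\ge 0}o_nx^n=\frac{1+x+x^2}{1-4x-4x^2-x^3}.$$
   Context: All graphs are finite and simple. A matching of a graph $G$ is a set of edges no two of which share a vertex; it is maximal if it is not a proper subset of another matching of $G$. $\Psi(G)$ denotes the number of maximal matchings of $G$. A hexagon is a cycle on 6 vertices. A chain hexagonal cactus of length $n\ge1$ is a graph that is the union of $n$ hexagons $h_1,\dots,h_n$ such that $h_i$ and $h_{i+1}$ share exactly one vertex (a cut vertex) for $1\le i\le n-1$, and $h_i,h_j$ are vertex-disjoint whenever $|i-j|\ge 2$ (for $n=1$ it is a single hexagon). For $2\le i\le n-1$ the internal hexagon $h_i$ contains two distinct cut vertices (the one shared with $h_{i-1}$ and the one shared with $h_{i+1}$); $h_i$ is called an ortho-, meta- or para-hexagon according as the distance in $h_i$ between these two cut vertices is $1$, $2$ or $3$. $P_n$ (resp. $M_n$, $O_n$) denotes the chain hexagonal cactus of length $n$ all of whose internal hexagons are para-hexagons (resp. meta-hexagons, ortho-hexagons); each is unique up to isomorphism. -}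

module Defs where

open import Data.Nat using (ℕ; zero; suc; _+_; _*_; _∸_; _≡ᵇ_)
open import Data.Bool using (Bool; true; false; _∧_; _∨_; not; if_then_else_)
open import Data.List using (List; []; _∷_; _++_; map; length; filter)
open import Data.Product using (_×_; _,_)
open import Data.Integer using (ℤ; +_) renaming (_+_ to _+ℤ_; _*_ to _*ℤ_)
open import Relation.Binary.PropositionalEquality using (_≡_)
open import Relation.Nullary.Decidable using (T?)

-- Finite simple graphs given by a vertex count and a list of edges
-- (unordered pairs of vertices, written as ordered pairs; no repeats).

Edge : Set
Edge = ℕ × ℕ

record Graph : Set where
  constructor mkGraph
  field
    nVertices : ℕ
    edges     : List Edge
open Graph public

-- Edge subsets: a subset of the edge list is a Bool-vector (list of
-- Booleans, one per edge).

allSubsets : ℕ → List (List Bool)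
allSubsets zero    = [] ∷ []
allSubsets (suc m) = map (true ∷_) (allSubsets m) ++ map (false ∷_) (allSubsets m)

select : List Bool → List Edge → List Edge
select (true  ∷ bs) (e ∷ es) = e ∷ select bs es
select (false ∷ bs) (e ∷ es) = select bs es
select _ _ = []

allᵇ : {A : Set} → (A → Bool) → List A → Bool
allᵇ p []       = true
allᵇ p (x ∷ xs) = p x ∧ allᵇ p xs

anyᵇ : {A : Set} → (A → Bool) → List A → Bool
anyᵇ p []       = false
anyᵇ p (x ∷ xs) = p x ∨ anyᵇ p xs

shareVertex : Edge → Edge → Bool
shareVertex (a , b) (c , d) = (a ≡ᵇ c) ∨ (a ≡ᵇ d) ∨ (b ≡ᵇ c) ∨ (b ≡ᵇ d)

isMatchingList : List Edge → Bool
isMatchingList []       = true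
isMatchingList (e ∷ es) = allᵇ (λ f → not (shareVertex e f)) es ∧ isMatchingList es

_⊆ᵇ_ : List Bool → List Bool → Bool
(x ∷ xs) ⊆ᵇ (y ∷ ys) = (not x ∨ y) ∧ (xs ⊆ᵇ ys)
_ ⊆ᵇ _ = true

_=ᵇ_ : List Bool → List Bool → Bool
xs =ᵇ ys = (xs ⊆ᵇ ys) ∧ (ys ⊆ᵇ xs)

isMatching : Graph → List Bool → Bool
isMatching G s = isMatchingList (select s (edges G))

isMaximalMatching : Graph → List Bool → Bool
isMaximalMatching G s =
  isMatching G s ∧
  not (anyᵇ (λ t → isMatching G t ∧ (s ⊆ᵇ t) ∧ not (s =ᵇ t))
           (allSubsets (length (edges G))))

Ψ : Graph → ℕ
Ψ G = length (filter (λ s → T? (isMaximalMatching G s)) (allSubsets (length (edges G))))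

-- Vertices 0 … 5n.  Hexagon i (0 ≤ i < n) has
-- vertex set {5i, …, 5i+5}; its cycle starts at 5i (position 0) and the
-- vertex 5i+5 (the cut vertex shared with hexagon i+1, if any) sits at
-- position d of the cycle, i.e. at distance d ∈ {1,2,3} from 5i.  The
-- remaining positions are filled by 5i+1, …, 5i+4 in order.  Thus every
-- internal hexagon is ortho (d=1), meta (d=2) or para (d=3).

cyclePositions : ℕ → ℕ → List ℕ   -- base b = 5i, distance d
cyclePositions b 1 = b ∷ b + 5 ∷ b + 1 ∷ b + 2 ∷ b + 3 ∷ b + 4 ∷ []
cyclePositions b 2 = b ∷ b + 1 ∷ b + 5 ∷ b + 2 ∷ b + 3 ∷ b + 4 ∷ []
cyclePositions b _ = b ∷ b + 1 ∷ b + 2 ∷ b + 5 ∷ b + 3 ∷ b + 4 ∷ []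

cycleEdges : List ℕ → List Edge
cycleEdges [] = []
cycleEdges (v ∷ vs) = go v (v ∷ vs)
  where
  go : ℕ → List ℕ → List Edge
  go first []            = []
  go first (x ∷ [])      = (x , first) ∷ []
  go first (x ∷ y ∷ ys)  = (x , y) ∷ go first (y ∷ ys)

hexEdges : ℕ → ℕ → List Edge     -- d, hexagon index i
hexEdges d i = cycleEdges (cyclePositions (5 * i) d)

chainEdges : ℕ → ℕ → List Edge   -- d, number of hexagons
chainEdges d zero    = []
chainEdges d (suc n) = chainEdges d n ++ hexEdges d n

chainCactus : ℕ → ℕ → Graph
chainCactus d n = mkGraph (5 * n + 1) (chainEdges d n)

P M O : ℕ → Graph
P n = chainCactus 3 n
M n = chainCactus 2 n
O n = chainCactus 1 n

-- Formal power series over ℤ, as coefficient sequences ℕ → ℤ.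

FPS : Set
FPS = ℕ → ℤ

poly : List ℤ → FPS
poly []       _       = + 0
poly (a ∷ as) zero    = a
poly (a ∷ as) (suc n) = poly as n

sumUpTo : ℕ → (ℕ → ℤ) → ℤ
sumUpTo zero    f = f 0
sumUpTo (suc n) f = sumUpTo n f +ℤ f (suc n)

_·_ : FPS → FPS → FPS
(f · g) n = sumUpTo n (λ k → f k *ℤ g (n ∸ k))

ΨSeq : (ℕ → Graph) → FPS
ΨSeq G zero    = + 1
ΨSeq G (suc n) = + Ψ (G (suc n))

-- "F = N / D" as formal power series, for D with constant term 1
-- (hence invertible): D · F = N coefficientwise.
_≡N/D_ : FPS → FPS × FPS → Set
F ≡N/D (N , D) = ∀ n → (D · F) n ≡ N n

module Submission where

-- 1. Maximality is local: a matching is maximal iff every edge it omits shares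
--    a vertex with one of its edges (maximal⇔dominating).
-- 2. Transfer matrix.  Cut a chain at the cut vertex v where the next hexagon
--    is attached.  An edge subset of the hexagons so far that can still grow
--    into a maximal matching is, as far as later hexagons are concerned, in
--    one of four live states: whether it covers v, and whether all its omitted
--    edges are already dominated.  Attaching a hexagon acts on these states
--    through the profile of the hexagon's own selection (glue), and every
--    hexagon has the same profiles as the first (translation invariance).  So
--    the vector counting subsets per state evolves by a fixed linear map
--    (histogram-step), and Ψ is its number of strict states (Ψ-strictCount).
-- 3. A linear relation among the first four state vectors, checked by
--    evaluation, persists along the orbit of this map (relation-persists).  It
--    is a recurrence for Ψ whose characteristic cubic is the denominator; the
--    first three terms give the numerator (chain-gf).

open import Defs
open import Data.Product using (_×_; _,_; ∃-syntax; proj₁; proj₂)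
open import Data.Integer using (+_; -[1+_])
open import Data.List using ([]; _∷_)

open import Data.Bool using (Bool; true; false; _∧_; _∨_; not; if_then_else_)
open import Data.Bool.Properties
  using (if-eta; ∧-comm; ∧-assoc; ∧-conicalˡ; ∧-conicalʳ; ∧-zeroʳ; ∧-identityʳ; ∨-assoc; ∨-zeroʳ;
         ∨-identityʳ; ∧-distribˡ-∨; ∧-distribʳ-∨; ∨-∧-booleanAlgebra)
open import Data.Bool.Solver using (module ∨-∧-Solver)
open import Algebra.Lattice.Properties.BooleanAlgebra ∨-∧-booleanAlgebra using (deMorgan₂)
open import Data.Nat using (ℕ; zero; suc; _+_; _*_; _∸_; _≡ᵇ_; _≤_; _<_; s≤s; _≤?_)
open import Data.Nat.Properties
  using (suc-injective; ≤-<-trans; ≤-trans; +-identityʳ; +-assoc; +-comm; +-suc; *-suc;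
         m≤m+n; m≤n+m; n≤1+n; +-monoʳ-≤; *-monoʳ-≤; *-distribˡ-+)
open import Data.Nat.GeneralisedArithmetic using (fold)
open import Data.Nat.Tactic.RingSolver using (solve-∀)
open import Data.Integer using (ℤ; _⊖_)
import Data.Integer as ℤ
import Data.Integer.Properties as ℤ
open import Data.Integer.Tactic.RingSolver using () renaming (solve-∀ to ℤ-solve-∀)
open import Data.List using (List; _++_; map; length; drop; filter)
open import Data.List.Properties using (length-map; length-++)
open import Data.List.Relation.Unary.All as All using (All; []; _∷_)
open import Data.List.Relation.Unary.All.Properties using (++⁺; map⁺)
open import Data.List.Relation.Unary.Any using (here; there)
open import Data.List.Relation.Binary.Sublist.Propositional using (_⊆_; []; _∷_; _∷ʳ_)
open import Data.List.Membership.Propositional using (_∈_)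
open import Data.List.Membership.Propositional.Properties using (∈-map⁺; ∈-++⁺ˡ; ∈-++⁺ʳ)
open import Data.Empty using (⊥; ⊥-elim)
open import Data.Unit using (tt)
open import Relation.Nullary using (Dec)
open import Relation.Nullary.Decidable using (toWitness; _×-dec_; T?)
open import Relation.Binary.PropositionalEquality

open ∨-∧-Solver using (solve; _:=_; _:*_; _:+_)

private variable
  b : Bool
  s s′ : List Bool
  x e : Edge
  E : List Edge

not-anyᵇ : {A : Set} (q : A → Bool) (xs : List A) → not (anyᵇ q xs) ≡ allᵇ (λ y → not (q y)) xs
not-anyᵇ q []       = refl
not-anyᵇ q (y ∷ xs) with q y
... | true  = refl
... | false = not-anyᵇ q xs

anyᵇ-∈ : {A : Set} {q : A → Bool} {y : A} {xs : List A} → y ∈ xs → q y ≡ true → anyᵇ q xs ≡ true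
anyᵇ-∈ (here refl) qy rewrite qy = refl
anyᵇ-∈ {q = q} {xs = z ∷ zs} (there y∈zs) qy rewrite anyᵇ-∈ {q = q} y∈zs qy = ∨-zeroʳ (q z)

anyᵇ-none : {A : Set} {q : A → Bool} {xs : List A} → All (λ y → q y ≡ false) xs → anyᵇ q xs ≡ false
anyᵇ-none []            = refl
anyᵇ-none (qy ∷ qs) rewrite qy = anyᵇ-none qs

allᵇ-++ : {A : Set} (q : A → Bool) (xs ys : List A) → allᵇ q (xs ++ ys) ≡ allᵇ q xs ∧ allᵇ q ys
allᵇ-++ q []       ys = refl
allᵇ-++ q (x ∷ xs) ys rewrite allᵇ-++ q xs ys = sym (∧-assoc (q x) (allᵇ q xs) (allᵇ q ys))

anyᵇ-++ : {A : Set} (q : A → Bool) (xs ys : List A) → anyᵇ q (xs ++ ys) ≡ anyᵇ q xs ∨ anyᵇ q ys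
anyᵇ-++ q []       ys = refl
anyᵇ-++ q (x ∷ xs) ys rewrite anyᵇ-++ q xs ys = sym (∨-assoc (q x) (anyᵇ q xs) (anyᵇ q ys))

allᵇ-map : {A B : Set} {q : B → Bool} {r : A → Bool} (f : A → B) (xs : List A) →
           (∀ x → q (f x) ≡ r x) → allᵇ q (map f xs) ≡ allᵇ r xs
allᵇ-map f []       eq = refl
allᵇ-map f (x ∷ xs) eq = cong₂ _∧_ (eq x) (allᵇ-map f xs eq)

anyᵇ-map : {A B : Set} {q : B → Bool} {r : A → Bool} (f : A → B) (xs : List A) →
           (∀ x → q (f x) ≡ r x) → anyᵇ q (map f xs) ≡ anyᵇ r xs
anyᵇ-map f []       eq = refl
anyᵇ-map f (x ∷ xs) eq = cong₂ _∨_ (eq x) (anyᵇ-map f xs eq)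

allSubsets-length : ∀ m → All (λ s → length s ≡ m) (allSubsets m)
allSubsets-length zero    = refl ∷ []
allSubsets-length (suc m) = ++⁺ (map⁺ (All.map (cong suc) (allSubsets-length m)))
                                (map⁺ (All.map (cong suc) (allSubsets-length m)))

allSubsets-complete : ∀ s → s ∈ allSubsets (length s)
allSubsets-complete []          = here refl
allSubsets-complete (true ∷ s)  = ∈-++⁺ˡ (∈-map⁺ (true ∷_) (allSubsets-complete s))
allSubsets-complete (false ∷ s) = ∈-++⁺ʳ _ (∈-map⁺ (false ∷_) (allSubsets-complete s))

-- Maximal matchings are dominating matchings

≡ᵇ-sym : ∀ m n → (m ≡ᵇ n) ≡ (n ≡ᵇ m)
≡ᵇ-sym zero    zero    = refl
≡ᵇ-sym zero    (suc n) = refl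
≡ᵇ-sym (suc m) zero    = refl
≡ᵇ-sym (suc m) (suc n) = ≡ᵇ-sym m n

shareVertex-sym : ∀ e f → shareVertex e f ≡ shareVertex f e
shareVertex-sym (a , b) (c , d)
  rewrite ≡ᵇ-sym c a | ≡ᵇ-sym c b | ≡ᵇ-sym d a | ≡ᵇ-sym d b =
  solve 4 (λ x y z w → x :+ (y :+ (z :+ w)) := x :+ (z :+ (y :+ w))) refl
    (a ≡ᵇ c) (a ≡ᵇ d) (b ≡ᵇ c) (b ≡ᵇ d)

dominated : List Edge → Edge → Bool
dominated M e = anyᵇ (shareVertex e) M

allUnselected : (Edge → Bool) → List Bool → List Edge → Bool
allUnselected p (true  ∷ s) (e ∷ E) = allUnselected p s E
allUnselected p (false ∷ s) (e ∷ E) = p e ∧ allUnselected p s E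
allUnselected p _           _       = true

-- Every edge left out by s is dominated by the selected edges, unless it is
-- excused.  With nothing excused this is the usual maximality condition.
dominating : List Edge → List Bool → (Edge → Bool) → Bool
dominating E s excused = allUnselected (λ e → dominated (select s E) e ∨ excused e) s E

noExcuse : Edge → Bool
noExcuse _ = false

data AddEdge : List Bool → List Bool → List Edge → Edge → Set where
  here  : AddEdge (false ∷ s) (true ∷ s) (e ∷ E) e
  there : AddEdge s s′ E e → AddEdge (b ∷ s) (b ∷ s′) (x ∷ E) e

allᵇ-add : (q : Edge → Bool) → AddEdge s s′ E e →
           allᵇ q (select s′ E) ≡ q e ∧ allᵇ q (select s E)
allᵇ-add q here = refl
allᵇ-add q (there {b = false} add) = allᵇ-add q add
allᵇ-add {e = e} q (there {b = true} {x = x} add) rewrite allᵇ-add q add =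
  solve 3 (λ a b c → a :* (b :* c) := b :* (a :* c)) refl (q x) (q e) _

isMatching-add : AddEdge s s′ E e →
  isMatchingList (select s′ E) ≡ isMatchingList (select s E) ∧ not (dominated (select s E) e)
isMatching-add {s = false ∷ s} {E = e ∷ E} here
  rewrite not-anyᵇ (shareVertex e) (select s E) =
  ∧-comm (allᵇ (λ f → not (shareVertex e f)) (select s E)) (isMatchingList (select s E))
isMatching-add (there {b = false} add) = isMatching-add add
isMatching-add {s = true ∷ s} {s′ = true ∷ s′} {E = x ∷ E} {e = e} (there add) = begin
  allᵇ notX (select s′ E) ∧ isMatchingList (select s′ E)
    ≡⟨ cong₂ _∧_ (allᵇ-add notX add) (isMatching-add add) ⟩
  (not (shareVertex x e) ∧ avoidsX) ∧ (matching ∧ not dom)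
    ≡⟨ solve 4 (λ n a m d → (n :* a) :* (m :* d) := (a :* m) :* (n :* d)) refl
         (not (shareVertex x e)) avoidsX matching (not dom) ⟩
  (avoidsX ∧ matching) ∧ (not (shareVertex x e) ∧ not dom)
    ≡⟨ cong ((avoidsX ∧ matching) ∧_) (sym (deMorgan₂ (shareVertex x e) dom)) ⟩
  (avoidsX ∧ matching) ∧ not (shareVertex x e ∨ dom)
    ≡⟨ cong (λ y → (avoidsX ∧ matching) ∧ not (y ∨ dom)) (shareVertex-sym x e) ⟩
  (avoidsX ∧ matching) ∧ not (shareVertex e x ∨ dom) ∎
  where
  open ≡-Reasoning
  notX : Edge → Bool
  notX f = not (shareVertex x f)
  avoidsX matching dom : Bool
  avoidsX = allᵇ notX (select s E)
  matching = isMatchingList (select s E)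
  dom = dominated (select s E) e

unsatisfied-edge : ∀ q s E → allUnselected q s E ≡ false →
                   ∃[ s′ ] ∃[ e ] AddEdge s s′ E e × q e ≡ false
unsatisfied-edge q (true ∷ s) (x ∷ E) h with unsatisfied-edge q s E h
... | s′ , e , add , qe = true ∷ s′ , e , there add , qe
unsatisfied-edge q (false ∷ s) (x ∷ E) h with q x in qx
... | false = true ∷ s , x , here , qx
... | true with unsatisfied-edge q s E h
...   | s′ , e , add , qe = false ∷ s′ , e , there add , qe

satisfied-edge : ∀ q → allUnselected q s E ≡ true → AddEdge s s′ E e → q e ≡ true
satisfied-edge q h here = ∧-conicalˡ _ _ h
satisfied-edge q h (there {b = true} add) = satisfied-edge q h add
satisfied-edge q h (there {b = false} add) = satisfied-edge q (∧-conicalʳ _ _ h) add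

⊆ᵇ-refl : ∀ s → (s ⊆ᵇ s) ≡ true
⊆ᵇ-refl []          = refl
⊆ᵇ-refl (true ∷ s)  = ⊆ᵇ-refl s
⊆ᵇ-refl (false ∷ s) = ⊆ᵇ-refl s

⊂ᵇ-add : AddEdge s s′ E e → (s ⊆ᵇ s′) ≡ true × (s′ ⊆ᵇ s) ≡ false
⊂ᵇ-add {s = false ∷ s} here = ⊆ᵇ-refl s , refl
⊂ᵇ-add (there {b = true} add) = ⊂ᵇ-add add
⊂ᵇ-add (there {b = false} add) = ⊂ᵇ-add add

add-length : AddEdge s s′ E e → length s′ ≡ length s
add-length here        = refl
add-length (there add) = cong suc (add-length add)

proper-superset-step : ∀ s t E → length s ≡ length E → length t ≡ length E →
  (s ⊆ᵇ t) ≡ true → (t ⊆ᵇ s) ≡ false →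
  ∃[ s′ ] ∃[ e ] AddEdge s s′ E e × (s′ ⊆ᵇ t) ≡ true
proper-superset-step [] [] [] _ _ _ ()
proper-superset-step (false ∷ s) (true ∷ t) (e ∷ E) _ _ s⊆t _ = true ∷ s , e , here , s⊆t
proper-superset-step (true ∷ s) (true ∷ t) (x ∷ E) ls lt s⊆t t⊈s
  with proper-superset-step s t E (suc-injective ls) (suc-injective lt) s⊆t t⊈s
... | s′ , e , add , s′⊆t = true ∷ s′ , e , there add , s′⊆t
proper-superset-step (false ∷ s) (false ∷ t) (x ∷ E) ls lt s⊆t t⊈s
  with proper-superset-step s t E (suc-injective ls) (suc-injective lt) s⊆t t⊈s
... | s′ , e , add , s′⊆t = false ∷ s′ , e , there add , s′⊆t
proper-superset-step (true ∷ s) (false ∷ t) (x ∷ E) _ _ () _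

select-⊆ : ∀ s t E → length s ≡ length t → (s ⊆ᵇ t) ≡ true → select s E ⊆ select t E
select-⊆ []          []          E       _ _ = []
select-⊆ (true ∷ s)  (true ∷ t)  []      _ _ = []
select-⊆ (true ∷ s)  (false ∷ t) []      _ _ = []
select-⊆ (false ∷ s) (true ∷ t)  []      _ _ = []
select-⊆ (false ∷ s) (false ∷ t) []      _ _ = []
select-⊆ (true ∷ s)  (true ∷ t)  (e ∷ E) l h = refl ∷ select-⊆ s t E (suc-injective l) h
select-⊆ (false ∷ s) (true ∷ t)  (e ∷ E) l h = e ∷ʳ select-⊆ s t E (suc-injective l) h
select-⊆ (false ∷ s) (false ∷ t) (e ∷ E) l h = select-⊆ s t E (suc-injective l) h
select-⊆ (true ∷ s)  (false ∷ t) (e ∷ E) l ()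

allᵇ-⊆ : {xs ys : List Edge} (q : Edge → Bool) → xs ⊆ ys → allᵇ q ys ≡ true → allᵇ q xs ≡ true
allᵇ-⊆ q []          h = refl
allᵇ-⊆ q (y ∷ʳ sub)  h = allᵇ-⊆ q sub (∧-conicalʳ _ _ h)
allᵇ-⊆ {x ∷ xs} {x ∷ ys} q (refl ∷ sub) h rewrite ∧-conicalˡ (q x) (allᵇ q ys) h =
  allᵇ-⊆ q sub (∧-conicalʳ (q x) (allᵇ q ys) h)

isMatchingList-⊆ : {xs ys : List Edge} → xs ⊆ ys → isMatchingList ys ≡ true → isMatchingList xs ≡ true
isMatchingList-⊆ []           h = refl
isMatchingList-⊆ (y ∷ʳ sub)   h = isMatchingList-⊆ sub (∧-conicalʳ _ _ h)
isMatchingList-⊆ {x ∷ xs} {x ∷ ys} (refl ∷ sub) h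
  rewrite allᵇ-⊆ (λ f → not (shareVertex x f)) sub (∧-conicalˡ _ (isMatchingList ys) h) =
  isMatchingList-⊆ sub (∧-conicalʳ _ (isMatchingList ys) h)

not-both : b ≡ true → not b ≡ true → ⊥
not-both refl ()

properlyExtends : Graph → List Bool → List Bool → Bool
properlyExtends G s t = isMatching G t ∧ (s ⊆ᵇ t) ∧ not (s =ᵇ t)

dominating⇒unextendable : ∀ k E s t → length s ≡ length E → length t ≡ length E →
  dominating E s noExcuse ≡ true → properlyExtends (mkGraph k E) s t ≡ false
dominating⇒unextendable k E s t ls lt dom
  with isMatchingList (select t E) in t-matching | s ⊆ᵇ t in s⊆t | t ⊆ᵇ s in t⊆s
... | false | _     | _     = refl
... | true  | false | _     = refl
... | true  | true  | true  = refl
... | true  | true  | false with proper-superset-step s t E ls lt s⊆t t⊆s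
...   | s′ , e , add , s′⊆t = ⊥-elim (not-both e-dominated e-undominated)
  where
  e-dominated : dominated (select s E) e ≡ true
  e-dominated = trans (sym (∨-identityʳ _)) (satisfied-edge _ dom add)
  s′-matching : isMatchingList (select s′ E) ≡ true
  s′-matching = isMatchingList-⊆
    (select-⊆ s′ t E (trans (add-length add) (trans ls (sym lt))) s′⊆t) t-matching
  e-undominated : not (dominated (select s E) e) ≡ true
  e-undominated = ∧-conicalʳ _ _ (trans (sym (isMatching-add add)) s′-matching)

add-extends : ∀ k → isMatchingList (select s E) ≡ true → dominated (select s E) e ≡ false →
  AddEdge s s′ E e → properlyExtends (mkGraph k E) s s′ ≡ true
add-extends k matching undominated add
  rewrite isMatching-add add | matching | undominated
        | proj₁ (⊂ᵇ-add add) | proj₂ (⊂ᵇ-add add) = refl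

undominating⇒extendable : ∀ k E s → isMatchingList (select s E) ≡ true →
  dominating E s noExcuse ≡ false →
  ∃[ t ] length t ≡ length s × properlyExtends (mkGraph k E) s t ≡ true
undominating⇒extendable k E s matching dom with unsatisfied-edge _ s E dom
... | s′ , e , add , e-free =
  s′ , add-length add , add-extends k matching (trans (sym (∨-identityʳ _)) e-free) add

maximal⇔dominating : ∀ k E s → length s ≡ length E →
  isMaximalMatching (mkGraph k E) s ≡ isMatchingList (select s E) ∧ dominating E s noExcuse
maximal⇔dominating k E s ls
  with isMatchingList (select s E) in matching | dominating E s noExcuse in dom
... | false | _    = refl
... | true  | true = cong not (anyᵇ-none (All.map (λ {t} lt → dominating⇒unextendable k E s t ls lt dom)
                                                 (allSubsets-length (length E))))
... | true  | false with undominating⇒extendable k E s matching dom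
...   | t , lt , extends = cong not (anyᵇ-∈ t∈subsets extends)
  where
  t∈subsets : t ∈ allSubsets (length E)
  t∈subsets = subst (λ m → t ∈ allSubsets m) (trans lt ls) (allSubsets-complete t)

-- Edge sets glued at a cut vertex

touches : ℕ → Edge → Bool
touches w (a , b) = (a ≡ᵇ w) ∨ (b ≡ᵇ w)

covers : ℕ → List Edge → Bool
covers w = anyᵇ (touches w)

Below Above : ℕ → Edge → Set
Below v (a , b) = a ≤ v × b ≤ v
Above v (a , b) = v ≤ a × v ≤ b

≡ᵇ-across : ∀ {x v y} → x ≤ v → v ≤ y → (x ≡ᵇ y) ≡ (x ≡ᵇ v) ∧ (y ≡ᵇ v)
≡ᵇ-across {zero}  {zero}  {zero}  _       _       = refl
≡ᵇ-across {zero}  {zero}  {suc y} _       _       = refl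
≡ᵇ-across {zero}  {suc v} {suc y} _       _       = refl
≡ᵇ-across {suc x} {suc v} {suc y} (s≤s p) (s≤s q) = ≡ᵇ-across p q

shareVertex-across : ∀ {v} e f → Below v e → Above v f →
                     shareVertex e f ≡ touches v e ∧ touches v f
shareVertex-across {v} (a , b) (c , d) (a≤v , b≤v) (v≤c , v≤d)
  rewrite ≡ᵇ-across a≤v v≤c | ≡ᵇ-across a≤v v≤d | ≡ᵇ-across b≤v v≤c | ≡ᵇ-across b≤v v≤d =
  solve 4 (λ x₀ x₁ x₂ x₃ → (x₀ :* x₂) :+ ((x₀ :* x₃) :+ ((x₁ :* x₂) :+ (x₁ :* x₃)))
                           := (x₀ :+ x₁) :* (x₂ :+ x₃))
    refl (a ≡ᵇ v) (b ≡ᵇ v) (c ≡ᵇ v) (d ≡ᵇ v)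

dominated-via : ∀ {v e M} {P : Edge → Set} →
  (∀ f → P f → shareVertex e f ≡ touches v e ∧ touches v f) →
  All P M → dominated M e ≡ touches v e ∧ covers v M
dominated-via {v} {e} meet [] = sym (∧-zeroʳ (touches v e))
dominated-via {v} {e} {f ∷ M} meet (pf ∷ pM) =
  trans (cong₂ _∨_ (meet f pf) (dominated-via {v} {e} meet pM))
        (sym (∧-distribˡ-∨ (touches v e) (touches v f) (covers v M)))

dominated-from-above : ∀ {v e M} → Below v e → All (Above v) M →
                       dominated M e ≡ touches v e ∧ covers v M
dominated-from-above {v} {e} below = dominated-via {v} {e} (λ f → shareVertex-across e f below)

dominated-from-below : ∀ {v e M} → Above v e → All (Below v) M →
                       dominated M e ≡ touches v e ∧ covers v M
dominated-from-below {v} {e} above = dominated-via {v} {e} λ f below → begin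
  shareVertex e f             ≡⟨ shareVertex-sym e f ⟩
  shareVertex f e             ≡⟨ shareVertex-across f e below above ⟩
  touches v f ∧ touches v e   ≡⟨ ∧-comm (touches v f) (touches v e) ⟩
  touches v e ∧ touches v f   ∎
  where open ≡-Reasoning

matching-++ : ∀ {v} A B → All (Below v) A → All (Above v) B →
  isMatchingList (A ++ B) ≡ isMatchingList A ∧ isMatchingList B ∧ not (covers v A ∧ covers v B)
matching-++ [] B [] _ = sym (∧-identityʳ (isMatchingList B))
matching-++ {v} (x ∷ A) B (below ∷ belowA) aboveB = begin
  allᵇ notX (A ++ B) ∧ isMatchingList (A ++ B)
    ≡⟨ cong₂ _∧_ (allᵇ-++ notX A B) (matching-++ A B belowA aboveB) ⟩
  (avoidsA ∧ allᵇ notX B) ∧ rest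
    ≡⟨ cong (λ y → (avoidsA ∧ y) ∧ rest) (sym (not-anyᵇ (shareVertex x) B)) ⟩
  (avoidsA ∧ not (dominated B x)) ∧ rest
    ≡⟨ cong (λ y → (avoidsA ∧ not y) ∧ rest) (dominated-from-above below aboveB) ⟩
  (avoidsA ∧ not (tx ∧ cB)) ∧ (mA ∧ mB ∧ not (cA ∧ cB))
    ≡⟨ solve 5 (λ a n m b n′ → (a :* n) :* (m :* (b :* n′)) := (a :* m) :* (b :* (n :* n′))) refl
         avoidsA (not (tx ∧ cB)) mA mB (not (cA ∧ cB)) ⟩
  (avoidsA ∧ mA) ∧ mB ∧ (not (tx ∧ cB) ∧ not (cA ∧ cB))
    ≡⟨ cong (λ y → (avoidsA ∧ mA) ∧ mB ∧ y) (sym (deMorgan₂ (tx ∧ cB) (cA ∧ cB))) ⟩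
  (avoidsA ∧ mA) ∧ mB ∧ not (tx ∧ cB ∨ cA ∧ cB)
    ≡⟨ cong (λ y → (avoidsA ∧ mA) ∧ mB ∧ not y) (sym (∧-distribʳ-∨ cB tx cA)) ⟩
  (avoidsA ∧ mA) ∧ mB ∧ not ((tx ∨ cA) ∧ cB) ∎
  where
  open ≡-Reasoning
  notX : Edge → Bool
  notX f = not (shareVertex x f)
  avoidsA mA mB tx cA cB rest : Bool
  avoidsA = allᵇ notX A
  mA = isMatchingList A
  mB = isMatchingList B
  tx = touches v x
  cA = covers v A
  cB = covers v B
  rest = mA ∧ mB ∧ not (cA ∧ cB)

<⇒≢ᵇ : ∀ {x y} → x < y → (x ≡ᵇ y) ≡ false
<⇒≢ᵇ {zero}  {suc y} _         = refl
<⇒≢ᵇ {suc x} {suc y} (s≤s x<y) = <⇒≢ᵇ x<y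

touches-beyond : ∀ {v w} e → v < w → Below v e → touches w e ≡ false
touches-beyond (a , b) v<w (a≤v , b≤v)
  rewrite <⇒≢ᵇ (≤-<-trans a≤v v<w) | <⇒≢ᵇ (≤-<-trans b≤v v<w) = refl

covers-beyond : ∀ {v w} M → v < w → All (Below v) M → covers w M ≡ false
covers-beyond []      v<w []             = refl
covers-beyond (e ∷ M) v<w (below ∷ belowM)
  rewrite touches-beyond e v<w below = covers-beyond M v<w belowM

select-++ : ∀ s₁ s₂ E₁ E₂ → length s₁ ≡ length E₁ →
            select (s₁ ++ s₂) (E₁ ++ E₂) ≡ select s₁ E₁ ++ select s₂ E₂
select-++ []           s₂ []       E₂ refl = refl
select-++ (true ∷ s₁)  s₂ (e ∷ E₁) E₂ l    = cong (e ∷_) (select-++ s₁ s₂ E₁ E₂ (suc-injective l))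
select-++ (false ∷ s₁) s₂ (e ∷ E₁) E₂ l    = select-++ s₁ s₂ E₁ E₂ (suc-injective l)

allUnselected-++ : ∀ q s₁ s₂ E₁ E₂ → length s₁ ≡ length E₁ →
  allUnselected q (s₁ ++ s₂) (E₁ ++ E₂) ≡ allUnselected q s₁ E₁ ∧ allUnselected q s₂ E₂
allUnselected-++ q []           s₂ []       E₂ refl = refl
allUnselected-++ q (true ∷ s₁)  s₂ (e ∷ E₁) E₂ l    = allUnselected-++ q s₁ s₂ E₁ E₂ (suc-injective l)
allUnselected-++ q (false ∷ s₁) s₂ (e ∷ E₁) E₂ l    =
  trans (cong (q e ∧_) (allUnselected-++ q s₁ s₂ E₁ E₂ (suc-injective l)))
        (sym (∧-assoc (q e) (allUnselected q s₁ E₁) (allUnselected q s₂ E₂)))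

allUnselected-cong : ∀ {P : Edge → Set} {q r} s E → All P E → (∀ e → P e → q e ≡ r e) →
                     allUnselected q s E ≡ allUnselected r s E
allUnselected-cong []          E       _        _  = refl
allUnselected-cong (true ∷ s)  []      _        _  = refl
allUnselected-cong (false ∷ s) []      _        _  = refl
allUnselected-cong (true ∷ s)  (e ∷ E) (_ ∷ pE) eq = allUnselected-cong s E pE eq
allUnselected-cong (false ∷ s) (e ∷ E) (pe ∷ pE) eq = cong₂ _∧_ (eq e pe) (allUnselected-cong s E pE eq)

allUnselected-if : ∀ c (q r : Edge → Bool) s E →
  allUnselected (λ e → if c then q e else r e) s E
  ≡ (if c then allUnselected q s E else allUnselected r s E)
allUnselected-if true  q r s E = refl
allUnselected-if false q r s E = refl

allUnselected-mono : ∀ {q r} s E → (∀ e → q e ≡ true → r e ≡ true) →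
                     allUnselected q s E ≡ true → allUnselected r s E ≡ true
allUnselected-mono []          E       _   _ = refl
allUnselected-mono (true ∷ s)  []      _   _ = refl
allUnselected-mono (false ∷ s) []      _   _ = refl
allUnselected-mono (true ∷ s)  (e ∷ E) q⇒r h = allUnselected-mono s E q⇒r h
allUnselected-mono {q} (false ∷ s) (e ∷ E) q⇒r h
  rewrite q⇒r e (∧-conicalˡ (q e) _ h) = allUnselected-mono s E q⇒r (∧-conicalʳ (q e) _ h)

All-select : ∀ {P : Edge → Set} s E → All P E → All P (select s E)
All-select []          E       _         = []
All-select (true ∷ s)  []      _         = []
All-select (false ∷ s) []      _         = []
All-select (true ∷ s)  (e ∷ E) (pe ∷ pE) = pe ∷ All-select s E pE
All-select (false ∷ s) (e ∷ E) (_ ∷ pE)  = All-select s E pE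

-- The left half of a glued selection: its omitted edges (all below v) can be
-- dominated from the right only through v.
absorb-left : ∀ a t c → (a ∨ t ∧ c) ∨ false ≡ (if c then a ∨ t else a ∨ false)
absorb-left a t true  rewrite ∧-identityʳ t = ∨-identityʳ (a ∨ t)
absorb-left a t false rewrite ∧-zeroʳ t = ∨-identityʳ (a ∨ false)

-- The right half: its omitted edges (all above v) are dominated from the left
-- only through v.
absorb-right : ∀ t c d q → (t ∧ c ∨ d) ∨ q ≡ (if c then d ∨ (t ∨ q) else d ∨ q)
absorb-right t true  d q rewrite ∧-identityʳ t =
  solve 3 (λ t d q → (t :+ d) :+ q := d :+ (t :+ q)) refl t d q
absorb-right t false d q rewrite ∧-zeroʳ t = refl

glue-dominating : ∀ {v} E₁ E₂ s₁ s₂ (q : Edge → Bool) →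
  All (Below v) E₁ → All (Above v) E₂ → length s₁ ≡ length E₁ → (∀ e → Below v e → q e ≡ false) →
  dominating (E₁ ++ E₂) (s₁ ++ s₂) q ≡
    (if covers v (select s₂ E₂) then dominating E₁ s₁ (touches v) else dominating E₁ s₁ noExcuse)
    ∧ (if covers v (select s₁ E₁) then dominating E₂ s₂ (λ e → touches v e ∨ q e)
                                  else dominating E₂ s₂ q)
glue-dominating {v} E₁ E₂ s₁ s₂ q below above len q-below = begin
  allUnselected (λ e → dominated (select (s₁ ++ s₂) (E₁ ++ E₂)) e ∨ q e) (s₁ ++ s₂) (E₁ ++ E₂)
    ≡⟨ cong (λ S → allUnselected (λ e → dominated S e ∨ q e) (s₁ ++ s₂) (E₁ ++ E₂))
            (select-++ s₁ s₂ E₁ E₂ len) ⟩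
  allUnselected glued (s₁ ++ s₂) (E₁ ++ E₂)
    ≡⟨ allUnselected-++ glued s₁ s₂ E₁ E₂ len ⟩
  allUnselected glued s₁ E₁ ∧ allUnselected glued s₂ E₂
    ≡⟨ cong₂ _∧_
         (trans (allUnselected-cong s₁ E₁ below left)
                (allUnselected-if cB (λ e → dominated A e ∨ touches v e)
                                     (λ e → dominated A e ∨ false) s₁ E₁))
         (trans (allUnselected-cong s₂ E₂ above right)
                (allUnselected-if cA (λ e → dominated B e ∨ (touches v e ∨ q e))
                                     (λ e → dominated B e ∨ q e) s₂ E₂)) ⟩
  _ ∎
  where
  open ≡-Reasoning
  A B : List Edge
  A = select s₁ E₁
  B = select s₂ E₂
  cA cB : Bool
  cA = covers v A
  cB = covers v B
  glued : Edge → Bool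
  glued e = dominated (A ++ B) e ∨ q e
  left : ∀ e → Below v e → glued e ≡ (if cB then dominated A e ∨ touches v e else dominated A e ∨ false)
  left e e-below
    rewrite anyᵇ-++ (shareVertex e) A B
          | dominated-from-above {v} {e} e-below (All-select s₂ E₂ above)
          | q-below e e-below = absorb-left (dominated A e) (touches v e) cB
  right : ∀ e → Above v e →
          glued e ≡ (if cA then dominated B e ∨ (touches v e ∨ q e) else dominated B e ∨ q e)
  right e e-above
    rewrite anyᵇ-++ (shareVertex e) A B
          | dominated-from-below {v} {e} e-above (All-select s₁ E₁ below) =
    absorb-right (touches v e) cA (dominated B e) (q e)

-- States of a partial selection

-- A selection s of the edges of a chain, seen from the cut vertex v where the
-- next hexagon is attached.  It can still grow into a maximal matching iff it
-- is a matching whose omitted edges are all dominated or contain v (later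
-- edges can only dominate those through v).  Such a selection is live, and
-- all that matters about it is whether it covers v and whether all its
-- omitted edges are already dominated (it is strict).
data State : Set where
  live : (covered strict : Bool) → State
  dead : State

-- (matching, covered, viable, strict)
Features : Set
Features = Bool × Bool × Bool × Bool

stateOf : Features → State
stateOf (m , c , o , t) = if m ∧ o then live c t else dead

features : ℕ → List Edge → List Bool → Features
features v E s =
  isMatchingList (select s E) , covers v (select s E) ,
  dominating E s (touches v) , dominating E s noExcuse

classify : ℕ → List Edge → List Bool → State
classify v E s = stateOf (features v E s)

strict⇒viable : ∀ v E s → dominating E s noExcuse ≡ true → dominating E s (touches v) ≡ true
strict⇒viable v E s = allUnselected-mono s E λ e h →
  cong (_∨ touches v e) (trans (sym (∨-identityʳ _)) h)

-- What a selection of the edges of one hexagon between the cut vertices v and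
-- w contributes to the state.
record Profile : Set where
  constructor profile
  field
    matching       : Bool
    coversLeft     : Bool
    coversRight    : Bool
    domAll         : Bool
    domUnlessLeft  : Bool
    domUnlessRight : Bool
    domUnlessBoth  : Bool
open Profile

profileOf : ℕ → ℕ → List Edge → List Bool → Profile
profileOf v w E s = profile
  (isMatchingList (select s E)) (covers v (select s E)) (covers w (select s E))
  (dominating E s noExcuse) (dominating E s (touches v)) (dominating E s (touches w))
  (dominating E s (λ e → touches v e ∨ touches w e))

-- The two parts must not both cover v; the
-- left part's omitted edges are settled if it was strict or the hexagon covers
-- v; the hexagon's omitted edges containing v are dominated iff the left part
-- covers v.
step : State → Profile → State
step dead       h = dead
step (live c t) h = stateOf
  ( matching h ∧ not (c ∧ coversLeft h)
  , coversRight h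
  , (if coversLeft h then true else t) ∧ (if c then domUnlessBoth h else domUnlessRight h)
  , (if coversLeft h then true else t) ∧ (if c then domUnlessLeft h else domAll h))

-- Classifying the features of a glued selection, written in terms of the
-- features (m, c, o, t) of its left part, agrees with stepping the left part's
-- state (a strict left part is viable, which rules out the remaining case).
stateOf-step : ∀ m c o t → (t ≡ true → o ≡ true) → ∀ h →
  stateOf ( m ∧ matching h ∧ not (c ∧ coversLeft h)
          , coversRight h
          , (if coversLeft h then o else t) ∧ (if c then domUnlessBoth h else domUnlessRight h)
          , (if coversLeft h then o else t) ∧ (if c then domUnlessLeft h else domAll h))
  ≡ step (stateOf (m , c , o , t)) h
stateOf-step false c o     t     _   h = refl
stateOf-step true  c true  t     _   h = refl
stateOf-step true  c false true  t⇒o h with t⇒o refl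
... | ()
stateOf-step true  c false false _   h
  rewrite if-eta (coversLeft h) {false} | ∧-zeroʳ (matching h ∧ not (c ∧ coversLeft h)) = refl

glue : ∀ {v w} E₁ E₂ s₁ s₂ → v < w → All (Below v) E₁ → All (Above v) E₂ → length s₁ ≡ length E₁ →
       classify w (E₁ ++ E₂) (s₁ ++ s₂) ≡ step (classify v E₁ s₁) (profileOf v w E₂ s₂)
glue {v} {w} E₁ E₂ s₁ s₂ v<w below above len =
  trans (cong stateOf (cong₂ _,_ glued-matching (cong₂ _,_ glued-covers
                        (cong₂ _,_ glued-viable glued-strict))))
        (stateOf-step (isMatchingList A) (covers v A) (dominating E₁ s₁ (touches v))
                      (dominating E₁ s₁ noExcuse) (strict⇒viable v E₁ s₁) (profileOf v w E₂ s₂))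
  where
  A B : List Edge
  A = select s₁ E₁
  B = select s₂ E₂
  glued-select : select (s₁ ++ s₂) (E₁ ++ E₂) ≡ A ++ B
  glued-select = select-++ s₁ s₂ E₁ E₂ len
  glued-matching : isMatchingList (select (s₁ ++ s₂) (E₁ ++ E₂))
                   ≡ isMatchingList A ∧ isMatchingList B ∧ not (covers v A ∧ covers v B)
  glued-matching = trans (cong isMatchingList glued-select)
                         (matching-++ A B (All-select s₁ E₁ below) (All-select s₂ E₂ above))
  glued-covers : covers w (select (s₁ ++ s₂) (E₁ ++ E₂)) ≡ covers w B
  glued-covers rewrite glued-select | anyᵇ-++ (touches w) A B
                     | covers-beyond A v<w (All-select s₁ E₁ below) = refl
  leftSettled : Bool
  leftSettled = if covers v B then dominating E₁ s₁ (touches v) else dominating E₁ s₁ noExcuse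
  glued-viable : dominating (E₁ ++ E₂) (s₁ ++ s₂) (touches w)
                 ≡ leftSettled ∧ (if covers v A then dominating E₂ s₂ (λ e → touches v e ∨ touches w e)
                                                else dominating E₂ s₂ (touches w))
  glued-viable = glue-dominating E₁ E₂ s₁ s₂ (touches w) below above len
                   (λ e e-below → touches-beyond e v<w e-below)
  glued-strict : dominating (E₁ ++ E₂) (s₁ ++ s₂) noExcuse
                 ≡ leftSettled ∧ (if covers v A then dominating E₂ s₂ (touches v)
                                                else dominating E₂ s₂ noExcuse)
  glued-strict = trans (glue-dominating E₁ E₂ s₁ s₂ noExcuse below above len (λ _ _ → refl))
                       (cong (λ d → leftSettled ∧ (if covers v A then d else dominating E₂ s₂ noExcuse))
                             (allUnselected-cong s₂ E₂ above
                               (λ e _ → cong (dominated B e ∨_) (∨-identityʳ (touches v e)))))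

-- Translation invariance

shift : ℕ → Edge → Edge
shift c (a , b) = c + a , c + b

≡ᵇ-shift : ∀ c a b → (c + a ≡ᵇ c + b) ≡ (a ≡ᵇ b)
≡ᵇ-shift zero    a b = refl
≡ᵇ-shift (suc c) a b = ≡ᵇ-shift c a b

shareVertex-shift : ∀ c e f → shareVertex (shift c e) (shift c f) ≡ shareVertex e f
shareVertex-shift c (a , b) (a′ , b′)
  rewrite ≡ᵇ-shift c a a′ | ≡ᵇ-shift c a b′ | ≡ᵇ-shift c b a′ | ≡ᵇ-shift c b b′ = refl

touches-shift : ∀ c w e → touches (c + w) (shift c e) ≡ touches w e
touches-shift c w (a , b) rewrite ≡ᵇ-shift c a w | ≡ᵇ-shift c b w = refl

isMatchingList-shift : ∀ c M → isMatchingList (map (shift c) M) ≡ isMatchingList M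
isMatchingList-shift c []      = refl
isMatchingList-shift c (e ∷ M) =
  cong₂ _∧_ (allᵇ-map (shift c) M (λ f → cong not (shareVertex-shift c e f)))
            (isMatchingList-shift c M)

covers-shift : ∀ c w M → covers (c + w) (map (shift c) M) ≡ covers w M
covers-shift c w M = anyᵇ-map (shift c) M (touches-shift c w)

select-map : ∀ (f : Edge → Edge) s E → select s (map f E) ≡ map f (select s E)
select-map f []          E       = refl
select-map f (true ∷ s)  []      = refl
select-map f (false ∷ s) []      = refl
select-map f (true ∷ s)  (e ∷ E) = cong (f e ∷_) (select-map f s E)
select-map f (false ∷ s) (e ∷ E) = select-map f s E

allUnselected-map : ∀ q (f : Edge → Edge) s E →
                    allUnselected q s (map f E) ≡ allUnselected (λ e → q (f e)) s E
allUnselected-map q f []          E       = refl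
allUnselected-map q f (true ∷ s)  []      = refl
allUnselected-map q f (false ∷ s) []      = refl
allUnselected-map q f (true ∷ s)  (e ∷ E) = allUnselected-map q f s E
allUnselected-map q f (false ∷ s) (e ∷ E) = cong (q (f e) ∧_) (allUnselected-map q f s E)

dominating-shift : ∀ c E s {q r : Edge → Bool} → (∀ e → q (shift c e) ≡ r e) →
                   dominating (map (shift c) E) s q ≡ dominating E s r
dominating-shift c E s {q} {r} eq = begin
  allUnselected (λ e → dominated (select s (map (shift c) E)) e ∨ q e) s (map (shift c) E)
    ≡⟨ cong (λ S → allUnselected (λ e → dominated S e ∨ q e) s (map (shift c) E))
            (select-map (shift c) s E) ⟩
  allUnselected (λ e → dominated (map (shift c) (select s E)) e ∨ q e) s (map (shift c) E)
    ≡⟨ allUnselected-map _ (shift c) s E ⟩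
  allUnselected (λ e → dominated (map (shift c) (select s E)) (shift c e) ∨ q (shift c e)) s E
    ≡⟨ allUnselected-cong s E (All.universal (λ _ → tt) E) (λ e _ →
         cong₂ _∨_ (anyᵇ-map (shift c) (select s E) (shareVertex-shift c e)) (eq e)) ⟩
  allUnselected (λ e → dominated (select s E) e ∨ r e) s E ∎
  where open ≡-Reasoning

profile-cong : ∀ {a b c d e f g a′ b′ c′ d′ e′ f′ g′} →
  a ≡ a′ → b ≡ b′ → c ≡ c′ → d ≡ d′ → e ≡ e′ → f ≡ f′ → g ≡ g′ →
  profile a b c d e f g ≡ profile a′ b′ c′ d′ e′ f′ g′
profile-cong refl refl refl refl refl refl refl = refl

profileOf-shift : ∀ c v w E s → profileOf (c + v) (c + w) (map (shift c) E) s ≡ profileOf v w E s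
profileOf-shift c v w E s = profile-cong
  (trans (cong isMatchingList shifted) (isMatchingList-shift c (select s E)))
  (trans (cong (covers (c + v)) shifted) (covers-shift c v (select s E)))
  (trans (cong (covers (c + w)) shifted) (covers-shift c w (select s E)))
  (dominating-shift c E s (λ _ → refl))
  (dominating-shift c E s (touches-shift c v))
  (dominating-shift c E s (touches-shift c w))
  (dominating-shift c E s (λ e → cong₂ _∨_ (touches-shift c v e) (touches-shift c w e)))
  where
  shifted : select s (map (shift c) E) ≡ map (shift c) (select s E)
  shifted = select-map (shift c) s E

cyclePositions-shift : ∀ b d → cyclePositions b d ≡ map (λ x → b + x) (cyclePositions 0 d)
cyclePositions-shift b d@0                   = cong (_∷ drop 1 (cyclePositions b d)) (sym (+-identityʳ b))
cyclePositions-shift b d@1                   = cong (_∷ drop 1 (cyclePositions b d)) (sym (+-identityʳ b))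
cyclePositions-shift b d@2                   = cong (_∷ drop 1 (cyclePositions b d)) (sym (+-identityʳ b))
cyclePositions-shift b d@(suc (suc (suc _))) = cong (_∷ drop 1 (cyclePositions b d)) (sym (+-identityʳ b))

cycleEdges-shift : ∀ c d →
  cycleEdges (map (λ x → c + x) (cyclePositions 0 d)) ≡ map (shift c) (hexEdges d 0)
cycleEdges-shift c 0                   = refl
cycleEdges-shift c 1                   = refl
cycleEdges-shift c 2                   = refl
cycleEdges-shift c (suc (suc (suc d))) = refl

hexagon-shift : ∀ d n → hexEdges d n ≡ map (shift (5 * n)) (hexEdges d 0)
hexagon-shift d n = trans (cong cycleEdges (cyclePositions-shift (5 * n) d)) (cycleEdges-shift (5 * n) d)

below? : ∀ v e → Dec (Below v e)
below? v (a , b) = (a ≤? v) ×-dec (b ≤? v)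

hexagon₀-below : ∀ d → All (Below 5) (hexEdges d 0)
hexagon₀-below 0                   = toWitness {a? = All.all? (below? 5) _} _
hexagon₀-below 1                   = toWitness {a? = All.all? (below? 5) _} _
hexagon₀-below 2                   = toWitness {a? = All.all? (below? 5) _} _
hexagon₀-below (suc (suc (suc d))) = toWitness {a? = All.all? (below? 5) _} _

five-suc : ∀ n → 5 * suc n ≡ 5 * n + 5
five-suc n = trans (*-suc 5 n) (+-comm 5 (5 * n))

hexagon-above : ∀ d n → All (Above (5 * n)) (hexEdges d n)
hexagon-above d n rewrite hexagon-shift d n =
  map⁺ (All.universal (λ (a , b) → m≤m+n (5 * n) a , m≤m+n (5 * n) b) (hexEdges d 0))

hexagon-below : ∀ d n → All (Below (5 * suc n)) (hexEdges d n)
hexagon-below d n rewrite hexagon-shift d n | five-suc n =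
  map⁺ (All.map (λ {(a , b)} (a≤5 , b≤5) → +-monoʳ-≤ (5 * n) a≤5 , +-monoʳ-≤ (5 * n) b≤5)
                (hexagon₀-below d))

chain-below : ∀ d n → All (Below (5 * n)) (chainEdges d n)
chain-below d zero    = []
chain-below d (suc n) = ++⁺ (All.map (λ {(a , b)} (a≤ , b≤) → ≤-trans a≤ 5n≤ , ≤-trans b≤ 5n≤)
                                     (chain-below d n))
                            (hexagon-below d n)
  where
  5n≤ : 5 * n ≤ 5 * suc n
  5n≤ = *-monoʳ-≤ 5 (n≤1+n n)

hexagon-length : ∀ d n → length (hexEdges d n) ≡ length (hexEdges d 0)
hexagon-length d n rewrite hexagon-shift d n = length-map (shift (5 * n)) (hexEdges d 0)

profile-hexagon : ∀ d n s →
  profileOf (5 * n) (5 * suc n) (hexEdges d n) s ≡ profileOf 0 5 (hexEdges d 0) s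
profile-hexagon d n s = begin
  profileOf (5 * n) (5 * suc n) (hexEdges d n) s
    ≡⟨ cong (λ E → profileOf (5 * n) (5 * suc n) E s) (hexagon-shift d n) ⟩
  profileOf (5 * n) (5 * suc n) (map (shift (5 * n)) (hexEdges d 0)) s
    ≡⟨ cong₂ (λ v w → profileOf v w (map (shift (5 * n)) (hexEdges d 0)) s)
             (sym (+-identityʳ (5 * n))) (five-suc n) ⟩
  profileOf (5 * n + 0) (5 * n + 5) (map (shift (5 * n)) (hexEdges d 0)) s
    ≡⟨ profileOf-shift (5 * n) 0 5 (hexEdges d 0) s ⟩
  profileOf 0 5 (hexEdges d 0) s ∎
  where open ≡-Reasoning

cut-vertices-increase : ∀ n → 5 * n < 5 * suc n
cut-vertices-increase n rewrite five-suc n | +-comm (5 * n) 5 = s≤s (m≤n+m (5 * n) 4)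

-- ℕ⁴ holds counts of selections in the states
-- live true true, live false true, live true false, live false false.
ℕ⁴ : Set
ℕ⁴ = ℕ × ℕ × ℕ × ℕ

0⁴ : ℕ⁴
0⁴ = 0 , 0 , 0 , 0

infixr 6 _⊕_
infixr 7 _⊛_

_⊕_ : ℕ⁴ → ℕ⁴ → ℕ⁴
(a₀ , a₁ , a₂ , a₃) ⊕ (b₀ , b₁ , b₂ , b₃) = a₀ + b₀ , a₁ + b₁ , a₂ + b₂ , a₃ + b₃

_⊛_ : ℕ → ℕ⁴ → ℕ⁴
k ⊛ (a₀ , a₁ , a₂ , a₃) = k * a₀ , k * a₁ , k * a₂ , k * a₃

≡⁴ : ∀ {a₀ a₁ a₂ a₃ b₀ b₁ b₂ b₃ : ℕ} → a₀ ≡ b₀ → a₁ ≡ b₁ → a₂ ≡ b₂ → a₃ ≡ b₃ →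
     (a₀ , a₁ , a₂ , a₃) ≡ (b₀ , b₁ , b₂ , b₃)
≡⁴ refl refl refl refl = refl

⊕-assoc : ∀ x y z → (x ⊕ y) ⊕ z ≡ x ⊕ (y ⊕ z)
⊕-assoc (x₀ , x₁ , x₂ , x₃) (y₀ , y₁ , y₂ , y₃) (z₀ , z₁ , z₂ , z₃) =
  ≡⁴ (+-assoc x₀ y₀ z₀) (+-assoc x₁ y₁ z₁) (+-assoc x₂ y₂ z₂) (+-assoc x₃ y₃ z₃)

⊕-identityʳ : ∀ x → x ⊕ 0⁴ ≡ x
⊕-identityʳ (x₀ , x₁ , x₂ , x₃) = ≡⁴ (+-identityʳ x₀) (+-identityʳ x₁) (+-identityʳ x₂) (+-identityʳ x₃)

dot : ℕ⁴ → ℕ⁴ → ℕ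
dot (a₀ , a₁ , a₂ , a₃) (x₀ , x₁ , x₂ , x₃) = a₀ * x₀ + (a₁ * x₁ + (a₂ * x₂ + a₃ * x₃))

-- The linear combination a₀x₀ + a₁x₁ + a₂x₂ + a₃x₃; its components are dot
-- products of a with the columns (x₀ᵢ, x₁ᵢ, x₂ᵢ, x₃ᵢ).
combine : ℕ⁴ → ℕ⁴ → ℕ⁴ → ℕ⁴ → ℕ⁴ → ℕ⁴
combine (a₀ , a₁ , a₂ , a₃) x₀ x₁ x₂ x₃ = a₀ ⊛ x₀ ⊕ a₁ ⊛ x₁ ⊕ a₂ ⊛ x₂ ⊕ a₃ ⊛ x₃

dot-⊕ : ∀ a b y → dot (a ⊕ b) y ≡ dot a y + dot b y
dot-⊕ (a₀ , a₁ , a₂ , a₃) (b₀ , b₁ , b₂ , b₃) (y₀ , y₁ , y₂ , y₃) =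
  identity a₀ a₁ a₂ a₃ b₀ b₁ b₂ b₃ y₀ y₁ y₂ y₃
  where
  identity : ∀ a₀ a₁ a₂ a₃ b₀ b₁ b₂ b₃ y₀ y₁ y₂ y₃ →
    (a₀ + b₀) * y₀ + ((a₁ + b₁) * y₁ + ((a₂ + b₂) * y₂ + (a₃ + b₃) * y₃))
    ≡ (a₀ * y₀ + (a₁ * y₁ + (a₂ * y₂ + a₃ * y₃))) + (b₀ * y₀ + (b₁ * y₁ + (b₂ * y₂ + b₃ * y₃)))
  identity = solve-∀

dot-⊛ : ∀ k a y → dot (k ⊛ a) y ≡ k * dot a y
dot-⊛ k (a₀ , a₁ , a₂ , a₃) (y₀ , y₁ , y₂ , y₃) = identity k a₀ a₁ a₂ a₃ y₀ y₁ y₂ y₃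
  where
  identity : ∀ k a₀ a₁ a₂ a₃ y₀ y₁ y₂ y₃ →
    k * a₀ * y₀ + (k * a₁ * y₁ + (k * a₂ * y₂ + k * a₃ * y₃))
    ≡ k * (a₀ * y₀ + (a₁ * y₁ + (a₂ * y₂ + a₃ * y₃)))
  identity = solve-∀

combine-⊕ : ∀ a b x₀ x₁ x₂ x₃ →
  combine (a ⊕ b) x₀ x₁ x₂ x₃ ≡ combine a x₀ x₁ x₂ x₃ ⊕ combine b x₀ x₁ x₂ x₃
combine-⊕ a b (p₀ , p₁ , p₂ , p₃) (q₀ , q₁ , q₂ , q₃) (r₀ , r₁ , r₂ , r₃) (t₀ , t₁ , t₂ , t₃) =
  ≡⁴ (dot-⊕ a b (p₀ , q₀ , r₀ , t₀)) (dot-⊕ a b (p₁ , q₁ , r₁ , t₁))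
     (dot-⊕ a b (p₂ , q₂ , r₂ , t₂)) (dot-⊕ a b (p₃ , q₃ , r₃ , t₃))

combine-⊛ : ∀ k a x₀ x₁ x₂ x₃ → combine (k ⊛ a) x₀ x₁ x₂ x₃ ≡ k ⊛ combine a x₀ x₁ x₂ x₃
combine-⊛ k a (p₀ , p₁ , p₂ , p₃) (q₀ , q₁ , q₂ , q₃) (r₀ , r₁ , r₂ , r₃) (t₀ , t₁ , t₂ , t₃) =
  ≡⁴ (dot-⊛ k a (p₀ , q₀ , r₀ , t₀)) (dot-⊛ k a (p₁ , q₁ , r₁ , t₁))
     (dot-⊛ k a (p₂ , q₂ , r₂ , t₂)) (dot-⊛ k a (p₃ , q₃ , r₃ , t₃))

linear : (State → ℕ⁴) → ℕ⁴ → ℕ⁴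
linear G x =
  combine x (G (live true true)) (G (live false true)) (G (live true false)) (G (live false false))

linear-⊕ : ∀ G x y → linear G (x ⊕ y) ≡ linear G x ⊕ linear G y
linear-⊕ G x y = combine-⊕ x y _ _ _ _

linear-⊛ : ∀ G k x → linear G (k ⊛ x) ≡ k ⊛ linear G x
linear-⊛ G k x = combine-⊛ k x _ _ _ _

linear-combine : ∀ G a x₀ x₁ x₂ x₃ →
  linear G (combine a x₀ x₁ x₂ x₃) ≡ combine a (linear G x₀) (linear G x₁) (linear G x₂) (linear G x₃)
linear-combine G (a₀ , a₁ , a₂ , a₃) x₀ x₁ x₂ x₃ =
  trans (linear-⊕ G (a₀ ⊛ x₀) (a₁ ⊛ x₁ ⊕ a₂ ⊛ x₂ ⊕ a₃ ⊛ x₃)) (cong₂ _⊕_ (linear-⊛ G a₀ x₀)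
  (trans (linear-⊕ G (a₁ ⊛ x₁) (a₂ ⊛ x₂ ⊕ a₃ ⊛ x₃)) (cong₂ _⊕_ (linear-⊛ G a₁ x₁)
  (trans (linear-⊕ G (a₂ ⊛ x₂) (a₃ ⊛ x₃)) (cong₂ _⊕_ (linear-⊛ G a₂ x₂) (linear-⊛ G a₃ x₃))))))

indicator : State → ℕ⁴
indicator (live true  true)  = 1 , 0 , 0 , 0
indicator (live false true)  = 0 , 1 , 0 , 0
indicator (live true  false) = 0 , 0 , 1 , 0
indicator (live false false) = 0 , 0 , 0 , 1
indicator dead               = 0⁴

+0+0 : ∀ y → (y + 0) + 0 ≡ y
+0+0 y = trans (+-identityʳ (y + 0)) (+-identityʳ y)

linear-indicator : ∀ G → G dead ≡ 0⁴ → ∀ σ → linear G (indicator σ) ≡ G σ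
linear-indicator G _ (live true  true)  = ≡⁴ (+0+0 _) (+0+0 _) (+0+0 _) (+0+0 _)
linear-indicator G _ (live false true)  = ≡⁴ (+0+0 _) (+0+0 _) (+0+0 _) (+0+0 _)
linear-indicator G _ (live true  false) = ≡⁴ (+0+0 _) (+0+0 _) (+0+0 _) (+0+0 _)
linear-indicator G _ (live false false) =
  ≡⁴ (+-identityʳ _) (+-identityʳ _) (+-identityʳ _) (+-identityʳ _)
linear-indicator G G-dead dead          = sym G-dead

sum⁴ : {A : Set} → (A → ℕ⁴) → List A → ℕ⁴
sum⁴ f []       = 0⁴
sum⁴ f (x ∷ xs) = f x ⊕ sum⁴ f xs

sum⁴-++ : {A : Set} (f : A → ℕ⁴) (xs ys : List A) → sum⁴ f (xs ++ ys) ≡ sum⁴ f xs ⊕ sum⁴ f ys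
sum⁴-++ f []       ys = refl
sum⁴-++ f (x ∷ xs) ys = trans (cong (f x ⊕_) (sum⁴-++ f xs ys)) (sym (⊕-assoc (f x) _ _))

sum⁴-map : {A B : Set} (f : B → ℕ⁴) (g : A → B) (xs : List A) →
           sum⁴ f (map g xs) ≡ sum⁴ (λ x → f (g x)) xs
sum⁴-map f g []       = refl
sum⁴-map f g (x ∷ xs) = cong (f (g x) ⊕_) (sum⁴-map f g xs)

sum⁴-cong : {A : Set} {f g : A → ℕ⁴} {xs : List A} → All (λ x → f x ≡ g x) xs → sum⁴ f xs ≡ sum⁴ g xs
sum⁴-cong []        = refl
sum⁴-cong (eq ∷ eqs) = cong₂ _⊕_ eq (sum⁴-cong eqs)

sum⁴-zero : {A : Set} (xs : List A) → sum⁴ (λ _ → 0⁴) xs ≡ 0⁴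
sum⁴-zero []       = refl
sum⁴-zero (x ∷ xs) = sum⁴-zero xs

sum⁴-linear : {A : Set} (G : State → ℕ⁴) (h : A → State) (xs : List A) → G dead ≡ 0⁴ →
              sum⁴ (λ x → G (h x)) xs ≡ linear G (sum⁴ (λ x → indicator (h x)) xs)
sum⁴-linear G h []       _      = refl
sum⁴-linear G h (x ∷ xs) G-dead =
  trans (cong₂ _⊕_ (sym (linear-indicator G G-dead (h x))) (sum⁴-linear G h xs G-dead))
        (sym (linear-⊕ G (indicator (h x)) (sum⁴ (λ y → indicator (h y)) xs)))

sum⁴-allSubsets-suc : ∀ (f : List Bool → ℕ⁴) m → sum⁴ f (allSubsets (suc m))
  ≡ sum⁴ (λ s → f (true ∷ s)) (allSubsets m) ⊕ sum⁴ (λ s → f (false ∷ s)) (allSubsets m)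
sum⁴-allSubsets-suc f m =
  trans (sum⁴-++ f (map (true ∷_) (allSubsets m)) (map (false ∷_) (allSubsets m)))
        (cong₂ _⊕_ (sum⁴-map f (true ∷_) (allSubsets m)) (sum⁴-map f (false ∷_) (allSubsets m)))

sum⁴-allSubsets-+ : ∀ a b (f : List Bool → ℕ⁴) → sum⁴ f (allSubsets (a + b))
  ≡ sum⁴ (λ s₁ → sum⁴ (λ s₂ → f (s₁ ++ s₂)) (allSubsets b)) (allSubsets a)
sum⁴-allSubsets-+ zero    b f = sym (⊕-identityʳ (sum⁴ f (allSubsets b)))
sum⁴-allSubsets-+ (suc a) b f =
  trans (sum⁴-allSubsets-suc f (a + b))
        (trans (cong₂ _⊕_ (sum⁴-allSubsets-+ a b (λ s → f (true ∷ s)))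
                          (sum⁴-allSubsets-+ a b (λ s → f (false ∷ s))))
               (sym (sum⁴-allSubsets-suc (λ s₁ → sum⁴ (λ s₂ → f (s₁ ++ s₂)) (allSubsets b)) a)))

-- The number of strict live selections counted by a vector.
strictCount : ℕ⁴ → ℕ
strictCount (a₀ , a₁ , _ , _) = a₀ + a₁

strictCount-⊕ : ∀ x y → strictCount (x ⊕ y) ≡ strictCount x + strictCount y
strictCount-⊕ (a₀ , a₁ , _ , _) (b₀ , b₁ , _ , _) = identity a₀ a₁ b₀ b₁
  where
  identity : ∀ a₀ a₁ b₀ b₁ → (a₀ + b₀) + (a₁ + b₁) ≡ (a₀ + a₁) + (b₀ + b₁)
  identity = solve-∀

strictCount-combine : ∀ a x₀ x₁ x₂ x₃ → strictCount (combine a x₀ x₁ x₂ x₃)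
  ≡ dot a (strictCount x₀ , strictCount x₁ , strictCount x₂ , strictCount x₃)
strictCount-combine (a₀ , a₁ , a₂ , a₃) x₀ x₁ x₂ x₃ =
  begin
    strictCount (a₀ ⊛ x₀ ⊕ a₁ ⊛ x₁ ⊕ a₂ ⊛ x₂ ⊕ a₃ ⊛ x₃)
  ≡⟨ strictCount-⊕ (a₀ ⊛ x₀) (a₁ ⊛ x₁ ⊕ a₂ ⊛ x₂ ⊕ a₃ ⊛ x₃) ⟩
    strictCount (a₀ ⊛ x₀) + strictCount (a₁ ⊛ x₁ ⊕ a₂ ⊛ x₂ ⊕ a₃ ⊛ x₃)
  ≡⟨ cong₂ _+_ (scale a₀ x₀) (trans (strictCount-⊕ (a₁ ⊛ x₁) (a₂ ⊛ x₂ ⊕ a₃ ⊛ x₃))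
               (cong₂ _+_ (scale a₁ x₁) (trans (strictCount-⊕ (a₂ ⊛ x₂) (a₃ ⊛ x₃))
                                               (cong₂ _+_ (scale a₂ x₂) (scale a₃ x₃))))) ⟩
    a₀ * strictCount x₀ + (a₁ * strictCount x₁ + (a₂ * strictCount x₂ + a₃ * strictCount x₃))
  ∎
  where
  open ≡-Reasoning
  scale : ∀ k x → strictCount (k ⊛ x) ≡ k * strictCount x
  scale k (b₀ , b₁ , _ , _) = sym (*-distribˡ-+ k b₀ b₁)

count-filter : {A : Set} (p : A → Bool) (f : A → ℕ⁴) (xs : List A) →
  All (λ x → strictCount (f x) ≡ (if p x then 1 else 0)) xs →
  length (filter (λ x → T? (p x)) xs) ≡ strictCount (sum⁴ f xs)
count-filter p f []       []         = refl
count-filter p f (x ∷ xs) (fx ∷ fxs)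
  rewrite strictCount-⊕ (f x) (sum⁴ f xs) | fx with p x
... | true  = cong suc (count-filter p f xs fxs)
... | false = count-filter p f xs fxs

strictCount-classify : ∀ v E s → strictCount (indicator (classify v E s))
  ≡ (if isMatchingList (select s E) ∧ dominating E s noExcuse then 1 else 0)
strictCount-classify v E s
  with isMatchingList (select s E) | covers v (select s E)
     | dominating E s (touches v) in viable | dominating E s noExcuse in strict
... | false | _     | _     | _     = refl
... | true  | true  | true  | true  = refl
... | true  | false | true  | true  = refl
... | true  | true  | true  | false = refl
... | true  | false | true  | false = refl
... | true  | _     | false | false = refl
... | true  | _     | false | true  with trans (sym (strict⇒viable v E s strict)) viable
...   | ()

Ψ-strictCount : ∀ k v E →
  Ψ (mkGraph k E) ≡ strictCount (sum⁴ (λ s → indicator (classify v E s)) (allSubsets (length E)))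
Ψ-strictCount k v E = count-filter _ _ (allSubsets (length E))
  (All.map (λ {s} len → trans (strictCount-classify v E s)
                              (cong (λ b → if b then 1 else 0) (sym (maximal⇔dominating k E s len))))
           (allSubsets-length (length E)))

-- The transfer matrix of a chain

histogram : ℕ → ℕ → ℕ⁴
histogram d n = sum⁴ (λ s → indicator (classify (5 * n) (chainEdges d n) s))
                     (allSubsets (length (chainEdges d n)))

transferColumn : ℕ → State → ℕ⁴
transferColumn d σ = sum⁴ (λ s → indicator (step σ (profileOf 0 5 (hexEdges d 0) s)))
                          (allSubsets (length (hexEdges d 0)))

transfer : ℕ → ℕ⁴ → ℕ⁴
transfer d = linear (transferColumn d)

histogram-step : ∀ d n → histogram d (suc n) ≡ transfer d (histogram d n)
histogram-step d n = begin
  sum⁴ F (allSubsets (length (chain ++ hex)))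
    ≡⟨ cong (λ m → sum⁴ F (allSubsets m)) (length-++ chain) ⟩
  sum⁴ F (allSubsets (length chain + length hex))
    ≡⟨ sum⁴-allSubsets-+ (length chain) (length hex) F ⟩
  sum⁴ (λ s₁ → sum⁴ (λ s₂ → F (s₁ ++ s₂)) (allSubsets (length hex))) (allSubsets (length chain))
    ≡⟨ sum⁴-cong (All.map (λ {s₁} → extend s₁) (allSubsets-length (length chain))) ⟩
  sum⁴ (λ s₁ → transferColumn d (classify (5 * n) chain s₁)) (allSubsets (length chain))
    ≡⟨ sum⁴-linear (transferColumn d) (classify (5 * n) chain) (allSubsets (length chain))
                   (sum⁴-zero (allSubsets (length (hexEdges d 0)))) ⟩
  transfer d (histogram d n) ∎
  where
  open ≡-Reasoning
  chain hex : List Edge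
  chain = chainEdges d n
  hex   = hexEdges d n
  F : List Bool → ℕ⁴
  F s = indicator (classify (5 * suc n) (chain ++ hex) s)
  extend : ∀ s₁ → length s₁ ≡ length chain →
    sum⁴ (λ s₂ → F (s₁ ++ s₂)) (allSubsets (length hex)) ≡ transferColumn d (classify (5 * n) chain s₁)
  extend s₁ len = trans
    (sum⁴-cong (All.universal (λ s₂ → cong indicator
      (trans (glue chain hex s₁ s₂ (cut-vertices-increase n) (chain-below d n) (hexagon-above d n) len)
             (cong (step (classify (5 * n) chain s₁)) (profile-hexagon d n s₂)))) _))
    (cong (λ m → sum⁴ (λ s₂ → indicator (step (classify (5 * n) chain s₁)
                                              (profileOf 0 5 (hexEdges d 0) s₂)))
                      (allSubsets m))
          (hexagon-length d n))

-- The orbit of the empty chain's histogram under the transfer map: it is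
-- computable by evaluation, and it consists of the histograms.
orbit : ℕ → ℕ → ℕ⁴
orbit d = fold (histogram d 0) (transfer d)

histogram≡orbit : ∀ d n → histogram d n ≡ orbit d n
histogram≡orbit d zero    = refl
histogram≡orbit d (suc n) = trans (histogram-step d n) (cong (transfer d) (histogram≡orbit d n))

ψ : ℕ → FPS
ψ d n = + strictCount (orbit d n)

ΨSeq-chain : ∀ d n → ΨSeq (chainCactus d) n ≡ ψ d n
ΨSeq-chain d zero    = refl
ΨSeq-chain d (suc n) = cong +_
  (trans (Ψ-strictCount (5 * suc n + 1) (5 * suc n) (chainEdges d (suc n)))
         (cong strictCount (histogram≡orbit d (suc n))))

relation-persists : ∀ G y a b → let Y = fold y (linear G) in
  combine a (Y 0) (Y 1) (Y 2) (Y 3) ≡ combine b (Y 0) (Y 1) (Y 2) (Y 3) →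
  ∀ k → combine a (Y k) (Y (1 + k)) (Y (2 + k)) (Y (3 + k))
      ≡ combine b (Y k) (Y (1 + k)) (Y (2 + k)) (Y (3 + k))
relation-persists G y a b base zero    = base
relation-persists G y a b base (suc k) =
  trans (sym (linear-combine G a (Y k) (Y (1 + k)) (Y (2 + k)) (Y (3 + k))))
        (trans (cong (linear G) (relation-persists G y a b base k))
               (linear-combine G b (Y k) (Y (1 + k)) (Y (2 + k)) (Y (3 + k))))
  where
  Y : ℕ → ℕ⁴
  Y = fold y (linear G)

-- From recurrences to rational generating functions

denominator : ℕ⁴ → ℕ⁴ → FPS
denominator (a₀ , a₁ , a₂ , a₃) (b₀ , b₁ , b₂ , b₃) =
  poly ((a₃ ⊖ b₃) ∷ (a₂ ⊖ b₂) ∷ (a₁ ⊖ b₁) ∷ (a₀ ⊖ b₀) ∷ [])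

+-dot : ∀ a₀ a₁ a₂ a₃ x₀ x₁ x₂ x₃ → + dot (a₀ , a₁ , a₂ , a₃) (x₀ , x₁ , x₂ , x₃)
  ≡ (+ a₀) ℤ.* (+ x₀) ℤ.+ ((+ a₁) ℤ.* (+ x₁) ℤ.+ ((+ a₂) ℤ.* (+ x₂) ℤ.+ (+ a₃) ℤ.* (+ x₃)))
+-dot a₀ a₁ a₂ a₃ x₀ x₁ x₂ x₃ =
  trans (ℤ.pos-+ (a₀ * x₀) _) (cong₂ ℤ._+_ (ℤ.pos-* a₀ x₀)
  (trans (ℤ.pos-+ (a₁ * x₁) _) (cong₂ ℤ._+_ (ℤ.pos-* a₁ x₁)
  (trans (ℤ.pos-+ (a₂ * x₂) _) (cong₂ ℤ._+_ (ℤ.pos-* a₂ x₂) (ℤ.pos-* a₃ x₃))))))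

balanced⇒vanishing : ∀ a₀ a₁ a₂ a₃ b₀ b₁ b₂ b₃ x₀ x₁ x₂ x₃ →
  dot (a₀ , a₁ , a₂ , a₃) (x₀ , x₁ , x₂ , x₃) ≡ dot (b₀ , b₁ , b₂ , b₃) (x₀ , x₁ , x₂ , x₃) →
  (a₃ ⊖ b₃) ℤ.* (+ x₃) ℤ.+ (a₂ ⊖ b₂) ℤ.* (+ x₂) ℤ.+ (a₁ ⊖ b₁) ℤ.* (+ x₁) ℤ.+ (a₀ ⊖ b₀) ℤ.* (+ x₀) ≡ + 0
balanced⇒vanishing a₀ a₁ a₂ a₃ b₀ b₁ b₂ b₃ x₀ x₁ x₂ x₃ balanced
  rewrite sym (ℤ.m-n≡m⊖n a₀ b₀) | sym (ℤ.m-n≡m⊖n a₁ b₁)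
        | sym (ℤ.m-n≡m⊖n a₂ b₂) | sym (ℤ.m-n≡m⊖n a₃ b₃) = begin
  _ ≡⟨ difference (+ a₀) (+ a₁) (+ a₂) (+ a₃) (+ b₀) (+ b₁) (+ b₂) (+ b₃) (+ x₀) (+ x₁) (+ x₂) (+ x₃) ⟩
  _ ≡⟨ cong₂ ℤ._-_ (sym (+-dot a₀ a₁ a₂ a₃ x₀ x₁ x₂ x₃)) (sym (+-dot b₀ b₁ b₂ b₃ x₀ x₁ x₂ x₃)) ⟩
  + dot avec xvec ℤ.- + dot bvec xvec ≡⟨ cong (λ n → + n ℤ.- + dot bvec xvec) balanced ⟩
  + dot bvec xvec ℤ.- + dot bvec xvec ≡⟨ ℤ.+-inverseʳ (+ dot bvec xvec) ⟩
  + 0 ∎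
  where
  open ≡-Reasoning
  avec bvec xvec : ℕ⁴
  avec = a₀ , a₁ , a₂ , a₃
  bvec = b₀ , b₁ , b₂ , b₃
  xvec = x₀ , x₁ , x₂ , x₃
  difference : ∀ A₀ A₁ A₂ A₃ B₀ B₁ B₂ B₃ X₀ X₁ X₂ X₃ →
    (A₃ ℤ.- B₃) ℤ.* X₃ ℤ.+ (A₂ ℤ.- B₂) ℤ.* X₂ ℤ.+ (A₁ ℤ.- B₁) ℤ.* X₁ ℤ.+ (A₀ ℤ.- B₀) ℤ.* X₀
    ≡ (A₀ ℤ.* X₀ ℤ.+ (A₁ ℤ.* X₁ ℤ.+ (A₂ ℤ.* X₂ ℤ.+ A₃ ℤ.* X₃)))
      ℤ.- (B₀ ℤ.* X₀ ℤ.+ (B₁ ℤ.* X₁ ℤ.+ (B₂ ℤ.* X₂ ℤ.+ B₃ ℤ.* X₃)))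
  difference = ℤ-solve-∀

sumUpTo-tail : ∀ n m (f : ℕ → ℤ) → (∀ j → f (suc (n + j)) ≡ + 0) → sumUpTo (n + m) f ≡ sumUpTo n f
sumUpTo-tail n zero    f tail = cong (λ m → sumUpTo m f) (+-identityʳ n)
sumUpTo-tail n (suc m) f tail rewrite +-suc n m =
  trans (cong (λ z → sumUpTo (n + m) f ℤ.+ z) (tail m))
        (trans (ℤ.+-identityʳ (sumUpTo (n + m) f)) (sumUpTo-tail n m f tail))

cubic-annihilates : ∀ (u : FPS) c₀ c₁ c₂ c₃ →
  (∀ k → c₀ ℤ.* u (3 + k) ℤ.+ c₁ ℤ.* u (2 + k) ℤ.+ c₂ ℤ.* u (1 + k) ℤ.+ c₃ ℤ.* u k ≡ + 0) →
  ∀ k → (poly (c₀ ∷ c₁ ∷ c₂ ∷ c₃ ∷ []) · u) (3 + k) ≡ + 0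
cubic-annihilates u c₀ c₁ c₂ c₃ recurrence k =
  trans (sumUpTo-tail 3 k _ (λ _ → refl)) (recurrence k)

rational-gf : ∀ (u : FPS) c₀ c₁ c₂ c₃ n₀ n₁ n₂ →
  (poly (c₀ ∷ c₁ ∷ c₂ ∷ c₃ ∷ []) · u) 0 ≡ n₀ →
  (poly (c₀ ∷ c₁ ∷ c₂ ∷ c₃ ∷ []) · u) 1 ≡ n₁ →
  (poly (c₀ ∷ c₁ ∷ c₂ ∷ c₃ ∷ []) · u) 2 ≡ n₂ →
  (∀ k → c₀ ℤ.* u (3 + k) ℤ.+ c₁ ℤ.* u (2 + k) ℤ.+ c₂ ℤ.* u (1 + k) ℤ.+ c₃ ℤ.* u k ≡ + 0) →
  u ≡N/D (poly (n₀ ∷ n₁ ∷ n₂ ∷ []) , poly (c₀ ∷ c₁ ∷ c₂ ∷ c₃ ∷ []))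
rational-gf u c₀ c₁ c₂ c₃ n₀ n₁ n₂ h₀ h₁ h₂ recurrence zero                = h₀
rational-gf u c₀ c₁ c₂ c₃ n₀ n₁ n₂ h₀ h₁ h₂ recurrence (suc zero)          = h₁
rational-gf u c₀ c₁ c₂ c₃ n₀ n₁ n₂ h₀ h₁ h₂ recurrence (suc (suc zero))    = h₂
rational-gf u c₀ c₁ c₂ c₃ n₀ n₁ n₂ h₀ h₁ h₂ recurrence (suc (suc (suc k))) =
  cubic-annihilates u c₀ c₁ c₂ c₃ recurrence k

sumUpTo-cong : ∀ n {f g : ℕ → ℤ} → (∀ k → f k ≡ g k) → sumUpTo n f ≡ sumUpTo n g
sumUpTo-cong zero    eq = eq 0
sumUpTo-cong (suc n) eq = cong₂ ℤ._+_ (sumUpTo-cong n eq) (eq (suc n))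

·-congʳ : ∀ (D : FPS) {u v : FPS} → (∀ n → u n ≡ v n) → ∀ n → (D · u) n ≡ (D · v) n
·-congʳ D eq n = sumUpTo-cong n (λ k → cong (D k ℤ.*_) (eq (n ∸ k)))

chain-gf : ∀ d a b n₀ n₁ n₂ →
  combine a (orbit d 0) (orbit d 1) (orbit d 2) (orbit d 3)
    ≡ combine b (orbit d 0) (orbit d 1) (orbit d 2) (orbit d 3) →
  (denominator a b · ψ d) 0 ≡ n₀ → (denominator a b · ψ d) 1 ≡ n₁ → (denominator a b · ψ d) 2 ≡ n₂ →
  ΨSeq (chainCactus d) ≡N/D (poly (n₀ ∷ n₁ ∷ n₂ ∷ []) , denominator a b)
chain-gf d a@(a₀ , a₁ , a₂ , a₃) b@(b₀ , b₁ , b₂ , b₃) n₀ n₁ n₂ relation h₀ h₁ h₂ n =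
  trans (·-congʳ (denominator a b) (ΨSeq-chain d) n)
        (rational-gf (ψ d) (a₃ ⊖ b₃) (a₂ ⊖ b₂) (a₁ ⊖ b₁) (a₀ ⊖ b₀) n₀ n₁ n₂ h₀ h₁ h₂ recurrence n)
  where
  u : ℕ → ℕ
  u k = strictCount (orbit d k)
  balanced : ∀ k → dot a (u k , u (1 + k) , u (2 + k) , u (3 + k))
                  ≡ dot b (u k , u (1 + k) , u (2 + k) , u (3 + k))
  balanced k = begin
    dot a (u k , u (1 + k) , u (2 + k) , u (3 + k))
      ≡⟨ strictCount-combine a (orbit d k) (orbit d (1 + k)) (orbit d (2 + k)) (orbit d (3 + k)) ⟨
    strictCount (combine a (orbit d k) (orbit d (1 + k)) (orbit d (2 + k)) (orbit d (3 + k)))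
      ≡⟨ cong strictCount (relation-persists (transferColumn d) (histogram d 0) a b relation k) ⟩
    strictCount (combine b (orbit d k) (orbit d (1 + k)) (orbit d (2 + k)) (orbit d (3 + k)))
      ≡⟨ strictCount-combine b (orbit d k) (orbit d (1 + k)) (orbit d (2 + k)) (orbit d (3 + k)) ⟩
    dot b (u k , u (1 + k) , u (2 + k) , u (3 + k)) ∎
    where open ≡-Reasoning
  recurrence : ∀ k → (a₃ ⊖ b₃) ℤ.* ψ d (3 + k) ℤ.+ (a₂ ⊖ b₂) ℤ.* ψ d (2 + k)
                     ℤ.+ (a₁ ⊖ b₁) ℤ.* ψ d (1 + k) ℤ.+ (a₀ ⊖ b₀) ℤ.* ψ d k ≡ + 0
  recurrence k = balanced⇒vanishing a₀ a₁ a₂ a₃ b₀ b₁ b₂ b₃ (u k) (u (1 + k)) (u (2 + k)) (u (3 + k))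
                                    (balanced k)

mainTheorem1 : (ΨSeq P ≡N/D (poly (+ 1 ∷ + 0 ∷ + 4 ∷ []) , poly (+ 1 ∷ -[1+ 4 ] ∷ + 4 ∷ -[1+ 3 ] ∷ [])))
    × (ΨSeq M ≡N/D (poly (+ 1 ∷ -[1+ 0 ] ∷ -[1+ 1 ] ∷ []) , poly (+ 1 ∷ -[1+ 5 ] ∷ + 3 ∷ -[1+ 1 ] ∷ [])))
    × (ΨSeq O ≡N/D (poly (+ 1 ∷ + 1 ∷ + 1 ∷ []) , poly (+ 1 ∷ -[1+ 3 ] ∷ -[1+ 3 ] ∷ -[1+ 0 ] ∷ [])))
mainTheorem1 =
  -- para: the state vectors satisfy Y(k+3) + 4Y(k+1) = 5Y(k+2) + 4Y(k)
    chain-gf 3 (0 , 4 , 0 , 1) (4 , 0 , 5 , 0) (+ 1) (+ 0) (+ 4) refl refl refl refl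
  -- meta: Y(k+3) + 3Y(k+1) = 6Y(k+2) + 2Y(k)
  , chain-gf 2 (0 , 3 , 0 , 1) (2 , 0 , 6 , 0) (+ 1) -[1+ 0 ] -[1+ 1 ] refl refl refl refl
  -- ortho: Y(k+3) = Y(k) + 4Y(k+1) + 4Y(k+2)
  , chain-gf 1 (0 , 0 , 0 , 1) (1 , 4 , 4 , 0) (+ 1) (+ 1) (+ 1) refl refl refl refl
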